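{- Let $R$ be a finite commutative Frobenius ring of characteristic $2$ and let $G=\{g_1,\dots,g_p\}$ be a finite group of odd order $p$. Let $v_1=\sum_{g\in G}\alpha_g g$ and $v_2=\sum_{g\in G}\beta_g g$ be elements of the group ring $RG$, let $\gamma_1,\gamma_2,\gamma_3,\gamma_4\in R$, and put $\delta_1=\sum_{g\in G}\alpha_g$, $\delta_2=\sum_{g\in G}\beta_g$, $\widehat{g}=\sum_{i=1}^p g_i\in RG$. Let $C_\sigma$ be the code over $R$ of length $4p+4$ generated by the matrix $M_\sigma$ (defined in the context). If (1) $v_1v_2=v_2v_1$; (2) $\sum_{i=1}^4\gamma_i^2=1$; (3) $v_1v_1^*+v_2v_2^*+(\gamma_2+\gamma_4)^2\widehat{g}+1=0$; (4) $v_1^*v_1+v_2^*v_2+(\gamma_2+\gamma_4)^2\widehat{g}+1=0$; and (5) $\gamma_1=\delta_1$ and $\gamma_3=\delta_2$, then $C_\sigma$ is a self-dual code of length $4p+4$.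
   Context: For a group ring $RG$ with $G=\{g_1,\dots,g_p\}$ (elements listed in a fixed order) and $v=\sum_{g\in G}\alpha_g g\in RG$, $\sigma(v)$ denotes the $p\times p$ matrix over $R$ whose $(i,j)$ entry is $\alpha_{g_i^{ -1}g_j}$. The canonical involution is $v^*=\sum_{g}\alpha_g g^{ -1}$. Define the $(p+1)\times(p+1)$ matrices $A=\begin{pmatrix}\gamma_1 & \gamma_2\cdots\gamma_2\\ \begin{smallmatrix}\gamma_2\\ \vdots\\ \gamma_2\end{smallmatrix} & \sigma(v_1)\end{pmatrix}$, $B=\begin{pmatrix}\gamma_3 & \gamma_4\cdots\gamma_4\\ \begin{smallmatrix}\gamma_4\\ \vdots\\ \gamma_4\end{smallmatrix} & \sigma(v_2)\end{pmatrix}$ (first row: one entry $\gamma_1$ (resp. $\gamma_3$) followed by $p$ copies of $\gamma_2$ (resp. $\gamma_4$); first column below it: $p$ copies of $\gamma_2$ (resp. $\gamma_4$); lower-right $p\times p$ block $\sigma(v_1)$ (resp. $\sigma(v_2)$)). Then $M_\sigma$ is the $(2p+2)\times(4p+4)$ matrix $\left[\, I_{2p+2} \;\middle|\; \begin{matrix} A & B\\ B^T & A^T\end{matrix}\,\right]$. A linear code $C\subseteq R^n$ is self-dual if $C=C^\perp$, where $C^\perp=\{w\in R^n: \sum_i w_iv_i=0 \ \forall v\in C\}$. -}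

module Defs where

open import Level using (Level; _⊔_)
open import Algebra.Bundles using (CommutativeRing)
open import Algebra.Structures using (IsGroup)
open import Data.Nat using (ℕ; zero; suc) renaming (_+_ to _+ℕ_)
open import Data.Fin using (Fin; zero; suc; splitAt)
open import Data.Fin.Properties using (_≟_)
open import Data.Sum using (_⊎_; inj₁; inj₂)
open import Data.Product using (Σ; ∃; _×_; _,_)
open import Relation.Binary.PropositionalEquality using (_≡_)
open import Relation.Nullary using (yes; no)
open import Function using (_⇔_)

-- A finite group of order p whose elements are g_1, …, g_p, listed in a
-- fixed order; we identify g_i with i : Fin p.
record FinGroup (p : ℕ) : Set where
  field
    _·_     : Fin p → Fin p → Fin p
    e       : Fin p
    inv     : Fin p → Fin p
    isGroup : IsGroup _≡_ _·_ e inv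

module _ {c ℓ : Level} (R : CommutativeRing c ℓ) where
  open CommutativeRing R

  open import Algebra.Properties.Monoid.Sum +-monoid using (sum)

  IsFiniteRing : Set (c ⊔ ℓ)
  IsFiniteRing = Σ ℕ λ n → Σ (Fin n → Carrier) λ f → ∀ x → ∃ λ i → f i ≈ x

  HasChar2 : Set ℓ
  HasChar2 = 1# + 1# ≈ 0#

  record IsIdeal (I : Carrier → Set (c ⊔ ℓ)) : Set (c ⊔ ℓ) where
    field
      resp   : ∀ {x y} → x ≈ y → I x → I y
      zero∈  : I 0#
      +-closed : ∀ {x y} → I x → I y → I (x + y)
      -‿closed : ∀ {x} → I x → I (- x)
      *-closed : ∀ r {x} → I x → I (r * x)

  Ann : (Carrier → Set (c ⊔ ℓ)) → Carrier → Set (c ⊔ ℓ)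
  Ann I x = ∀ y → I y → x * y ≈ 0#

  -- Frobenius (for finite commutative rings = quasi-Frobenius): every ideal
  -- satisfies the double annihilator condition Ann(Ann(I)) = I.
  IsFrobenius : Set (Level.suc (c ⊔ ℓ))
  IsFrobenius = ∀ (I : Carrier → Set (c ⊔ ℓ)) → IsIdeal I →
                ∀ x → Ann (Ann I) x → I x

  module _ {p : ℕ} (G : FinGroup p) where
    open FinGroup G

    RG : Set c
    RG = Fin p → Carrier

    _·RG_ : RG → RG → RG
    (u ·RG v) g = sum (λ h → u h * v (inv h · g))

    _+RG_ : RG → RG → RG
    (u +RG v) g = u g + v g

    _•RG_ : Carrier → RG → RG
    (r •RG v) g = r * v g

    1RG : RG
    1RG g with g ≟ e
    ... | yes _ = 1#
    ... | no  _ = 0#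

    0RG : RG
    0RG _ = 0#

    ghat : RG
    ghat _ = 1#

    _⋆ : RG → RG
    (v ⋆) g = v (inv g)

    _≈RG_ : RG → RG → Set ℓ
    u ≈RG v = ∀ g → u g ≈ v g

    aug : RG → Carrier
    aug v = sum v

    σ : RG → Fin p → Fin p → Carrier
    σ v i j = v (inv i · j)

    bordered : Carrier → Carrier → RG → Fin (suc p) → Fin (suc p) → Carrier
    bordered a b v zero    zero    = a
    bordered a b v zero    (suc j) = b
    bordered a b v (suc i) zero    = b
    bordered a b v (suc i) (suc j) = σ v i j

    -- the (2p+2)×(4p+4) generator matrix M_σ = [ I | (A B ; Bᵀ Aᵀ) ]
    Mσ : (γ₁ γ₂ γ₃ γ₄ : Carrier) (v₁ v₂ : RG) →
         Fin (suc p +ℕ suc p) → Fin ((suc p +ℕ suc p) +ℕ (suc p +ℕ suc p)) → Carrier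
    Mσ γ₁ γ₂ γ₃ γ₄ v₁ v₂ r col with splitAt (suc p +ℕ suc p) col
    ... | inj₁ k with r ≟ k
    ...   | yes _ = 1#
    ...   | no  _ = 0#
    Mσ γ₁ γ₂ γ₃ γ₄ v₁ v₂ r col | inj₂ k with splitAt (suc p) r | splitAt (suc p) k
    ... | inj₁ i | inj₁ j = bordered γ₁ γ₂ v₁ i j
    ... | inj₁ i | inj₂ j = bordered γ₃ γ₄ v₂ i j
    ... | inj₂ i | inj₁ j = bordered γ₃ γ₄ v₂ j i
    ... | inj₂ i | inj₂ j = bordered γ₁ γ₂ v₁ j i

  Word : ℕ → Set c
  Word n = Fin n → Carrier

  InSpan : {k n : ℕ} → (Fin k → Fin n → Carrier) → Word n → Set (c ⊔ ℓ)
  InSpan {k} M w = ∃ λ (x : Fin k → Carrier) → ∀ j → w j ≈ sum (λ i → x i * M i j)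

  ⟨_,_⟩ : {n : ℕ} → Word n → Word n → Carrier
  ⟨ u , v ⟩ = sum (λ i → u i * v i)

  InDual : {n : ℕ} → (Word n → Set (c ⊔ ℓ)) → Word n → Set (c ⊔ ℓ)
  InDual C w = ∀ v → C v → ⟨ w , v ⟩ ≈ 0#

  SelfDual : {n : ℕ} → (Word n → Set (c ⊔ ℓ)) → Set (c ⊔ ℓ)
  SelfDual C = ∀ w → C w ⇔ InDual C w

{-# OPTIONS --safe #-}

-- M_σ = [1 ∣ X] with X = (A B ; Bᵀ Aᵀ) for the bordered matrices A, B. In characteristic 2 and
-- for odd p, bordered matrices whose corner is the augmentation multiply as
-- ⟦a,b,v⟧ ⟦a′,b′,w⟧ = ⟦aa′ + bb′, ab′ + ba′, bb′ĝ + vw⟧, and ⟦a,b,v⟧ᵀ = ⟦a,b,v*⟧. So the hypotheses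
-- say exactly that A Aᵀ + B Bᵀ = 1, Aᵀ A + Bᵀ B = 1 and A B = B A, which give X Xᵀ = 1. The rows of
-- M_σ are then pairwise orthogonal (1 + 1 = 0), and the code is self-orthogonal. Conversely a word
-- (a, b) orthogonal to every row has a = X b; as R is finite, X Xᵀ = 1 forces Xᵀ X = 1, so
-- (a, b) = a M_σ lies in the code.

module Submission where

open import Defs hiding (⟨_,_⟩)

open import Level using (Level; _⊔_; 0ℓ)
open import Algebra.Bundles using (CommutativeRing; Group)
open import Data.Bool.Base using (if_then_else_)
open import Data.Fin.Base using (Fin; zero; suc; toℕ; _↑ˡ_; _↑ʳ_; splitAt; join; combine; remQuot)
open import Data.Fin.Permutation using (permutation)
open import Data.Fin.Properties using (_≟_; join-splitAt; pigeonhole; remQuot-combine)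
open import Data.Nat.Base using (ℕ; zero; suc; _%_) renaming (_+_ to _+ℕ_; _*_ to _*ℕ_)
open import Data.Nat.Properties using (n<1+n; +-suc; m≤n⇒∃[o]m+o≡n)
open import Data.Nat.GeneralisedArithmetic using (fold; fold-+)
open import Data.Product.Base using (Σ; ∃; _×_; _,_; proj₁; proj₂)
open import Data.Sum.Base using ([_,_]; inj₁; inj₂)
open import Data.Vec.Functional using (Vector; _++_; _∷_; head; tail)
open import Data.Vec.Functional.Properties using (lookup-++ˡ; lookup-++ʳ)
open import Function.Base using (_∘_)
open import Function.Bundles using (_⇔_; mk⇔)
open import Function.Definitions using (Congruent)
open import Relation.Binary.Bundles using (Setoid)
open import Relation.Binary.PropositionalEquality as ≡ using (_≡_)
open import Relation.Nullary.Decidable.Core using (does; yes; no)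
open import Relation.Nullary.Decidable using (does-⇔)

private
  variable
    k m n : ℕ

↑-elim : ∀ {p} (P : Fin (m +ℕ n) → Set p) →
         (∀ i → P (i ↑ˡ n)) → (∀ j → P (m ↑ʳ j)) → ∀ k → P k
↑-elim {m} {n} P left right k =
  ≡.subst P (join-splitAt m n k) ([_,_] {C = P ∘ join m n} left right (splitAt m k))

IsFinite : ∀ {a ℓ} → Setoid a ℓ → Set (a ⊔ ℓ)
IsFinite S = Σ ℕ λ N → Σ (Fin N → Carrier) λ enum → ∀ x → ∃ λ i → enum i ≈ x
  where open Setoid S

module _ {a ℓ} (S : Setoid a ℓ) where
  open Setoid S
  open import Relation.Binary.Reasoning.Setoid S
  open import Data.Vec.Functional.Relation.Binary.Equality.Setoid S using (_≋_; ≋-setoid; ≋-trans; ≋-reflexive)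

  module _ (finite : IsFinite S) {f g : Carrier → Carrier}
           (f-cong : Congruent _≈_ _≈_ f) (g-cong : Congruent _≈_ _≈_ g)
           (f∘g≈id : ∀ x → f (g x) ≈ x) where

    private
      N : ℕ
      N = proj₁ finite

      enum : Fin N → Carrier
      enum = proj₁ (proj₂ finite)

      onto : ∀ x → ∃ λ i → enum i ≈ x
      onto = proj₂ (proj₂ finite)

      gⁿ-injective : ∀ n {x y} → fold x g n ≈ fold y g n → x ≈ y
      gⁿ-injective zero    eq = eq
      gⁿ-injective (suc n) eq = gⁿ-injective n (trans (sym (f∘g≈id _)) (trans (f-cong eq) (f∘g≈id _)))

      -- The orbit x, g x, g² x, … of x repeats; cancelling the common prefix puts x in the image of g.
      g-surjective : ∀ x → ∃ λ z → x ≈ g z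
      g-surjective x
        with i , j , i<j , same ← pigeonhole (n<1+n N) (λ k → proj₁ (onto (fold x g (toℕ k))))
        with d , i+1+d≡j ← m≤n⇒∃[o]m+o≡n i<j
        = fold x g d , gⁿ-injective (toℕ i) (begin
          fold x g (toℕ i)                 ≈⟨ proj₂ (onto _) ⟨
          enum _                           ≡⟨ ≡.cong enum same ⟩
          enum _                           ≈⟨ proj₂ (onto _) ⟩
          fold x g (toℕ j)                 ≡⟨ ≡.cong (fold x g) (≡.trans (+-suc (toℕ i) d) i+1+d≡j) ⟨
          fold x g (toℕ i +ℕ suc d)        ≡⟨ fold-+ x g (toℕ i) ⟩
          fold (g (fold x g d)) g (toℕ i)  ∎)

    inverseˡ⇒inverseʳ : ∀ x → g (f x) ≈ x
    inverseˡ⇒inverseʳ x with z , x≈gz ← g-surjective x = begin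
      g (f x)      ≈⟨ g-cong (f-cong x≈gz) ⟩
      g (f (g z))  ≈⟨ g-cong (f∘g≈id z) ⟩
      g z          ≈⟨ x≈gz ⟨
      x            ∎

  Vector-finite : IsFinite S → ∀ n → IsFinite (≋-setoid n)
  Vector-finite _ zero = 1 , (λ _ ()) , λ _ → zero , λ ()
  Vector-finite finite@(M , enum , onto) (suc n)
    with N , enumᵥ , ontoᵥ ← Vector-finite finite n
    = M *ℕ N , enum′ ∘ remQuot N , onto′
    where
    enum′ : Fin M × Fin N → Vector Carrier (suc n)
    enum′ (i , j) = enum i ∷ enumᵥ j
    onto′ : ∀ v → ∃ λ k → enum′ (remQuot N k) ≋ v
    onto′ v with i , enum-i≈v₀ ← onto (head v) | j , enumᵥ-j≋v₊ ← ontoᵥ (tail v)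
      = combine i j , ≋-trans (≋-reflexive (≡.cong enum′ (remQuot-combine i j))) λ
        { zero    → enum-i≈v₀
        ; (suc t) → enumᵥ-j≋v₊ t }

module Characteristic2 {c ℓ} (R : CommutativeRing c ℓ) (char2 : HasChar2 R) where
  open CommutativeRing R hiding (zero)
  open import Algebra.Properties.Semiring.Sum semiring using (sum)
  open import Relation.Binary.Reasoning.Setoid setoid

  x+x≈0 : ∀ x → x + x ≈ 0#
  x+x≈0 x = begin
    x + x            ≈⟨ +-cong (*-identityˡ x) (*-identityˡ x) ⟨
    1# * x + 1# * x  ≈⟨ distribʳ x 1# 1# ⟨
    (1# + 1#) * x    ≈⟨ *-congʳ char2 ⟩
    0# * x           ≈⟨ zeroˡ x ⟩
    0#               ∎

  x+y≈0⇒x≈y : ∀ {x y} → x + y ≈ 0# → x ≈ y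
  x+y≈0⇒x≈y {x} {y} x+y≈0 = begin
    x            ≈⟨ +-identityʳ x ⟨
    x + 0#       ≈⟨ +-congˡ (x+x≈0 y) ⟨
    x + (y + y)  ≈⟨ +-assoc x y y ⟨
    x + y + y    ≈⟨ +-congʳ x+y≈0 ⟩
    0# + y       ≈⟨ +-identityˡ y ⟩
    y            ∎

  x≈y⇒x+y≈0 : ∀ {x y} → x ≈ y → x + y ≈ 0#
  x≈y⇒x+y≈0 {y = y} x≈y = trans (+-congʳ x≈y) (x+x≈0 y)

  [x+y]²≈x²+y² : ∀ x y → (x + y) * (x + y) ≈ x * x + y * y
  [x+y]²≈x²+y² x y = begin
    (x + y) * (x + y)                  ≈⟨ distribʳ (x + y) x y ⟩
    x * (x + y) + y * (x + y)          ≈⟨ +-cong (distribˡ x x y) (distribˡ y x y) ⟩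
    (x * x + x * y) + (y * x + y * y)  ≈⟨ +-assoc (x * x) (x * y) _ ⟩
    x * x + (x * y + (y * x + y * y))  ≈⟨ +-congˡ (+-assoc (x * y) (y * x) _) ⟨
    x * x + ((x * y + y * x) + y * y)  ≈⟨ +-congˡ (+-congʳ (x≈y⇒x+y≈0 (*-comm x y))) ⟩
    x * x + (0# + y * y)               ≈⟨ +-congˡ (+-identityˡ (y * y)) ⟩
    x * x + y * y                      ∎

  sum-const-odd : ∀ n → n % 2 ≡ 1 → ∀ x → sum {n} (λ _ → x) ≈ x
  sum-const-odd (suc zero)    _     x = +-identityʳ x
  sum-const-odd (suc (suc n)) n-odd x = begin
    x + (x + sum {n} (λ _ → x))  ≈⟨ +-assoc x x _ ⟨
    (x + x) + sum {n} (λ _ → x)  ≈⟨ +-congʳ (x+x≈0 x) ⟩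
    0# + sum {n} (λ _ → x)       ≈⟨ +-identityˡ _ ⟩
    sum {n} (λ _ → x)            ≈⟨ sum-const-odd n n-odd x ⟩
    x                            ∎

module Matrices {c ℓ} (R : CommutativeRing c ℓ) where
  open CommutativeRing R hiding (zero)
  open import Algebra.Properties.Semiring.Sum semiring
    using (sum; sum-cong-≋; sum-replicate-zero; ∑-comm; *-distribˡ-sum; *-distribʳ-sum)
  open import Data.Vec.Functional.Relation.Binary.Equality.Setoid setoid using (_≋_)
  open import Relation.Binary.Reasoning.Setoid setoid

  Matrix : ℕ → ℕ → Set c
  Matrix m n = Fin m → Fin n → Carrier

  _ᵀ : Matrix m n → Matrix n m
  (M ᵀ) i j = M j i

  ⟨_,_⟩ : Vector Carrier n → Vector Carrier n → Carrier
  ⟨ u , v ⟩ = Defs.⟨_,_⟩ R u v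

  _*ᵛ_ : Matrix m n → Vector Carrier n → Vector Carrier m
  (M *ᵛ v) i = ⟨ M i , v ⟩

  _ᵛ*_ : Vector Carrier m → Matrix m n → Vector Carrier n
  (v ᵛ* M) j = ⟨ v , (M ᵀ) j ⟩

  _*ᴹ_ : Matrix m n → Matrix n k → Matrix m k
  (M *ᴹ N) i = M i ᵛ* N

  _+ᴹ_ : Matrix m n → Matrix m n → Matrix m n
  (M +ᴹ N) i j = M i j + N i j

  _≈ᴹ_ : Matrix m n → Matrix m n → Set ℓ
  M ≈ᴹ N = ∀ i j → M i j ≈ N i j

  -- Via does, 𝟙 (suc i) (suc j) reduces to 𝟙 i j.
  𝟙 : Matrix n n
  𝟙 i j = if does (i ≟ j) then 1# else 0#

  _∣_ : Matrix m n → Matrix m k → Matrix m (n +ℕ k)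
  (M ∣ N) i = M i ++ N i

  infix  8 _ᵀ
  infixr 7 _*ᵛ_
  infixl 7 _ᵛ*_
  infixl 7 _*ᴹ_
  infix  4 _≈ᴹ_
  infixl 6 _+ᴹ_
  infixr 5 _∣_

  ⟨⟩-cong : ∀ {u u′ v v′ : Vector Carrier n} → u ≋ u′ → v ≋ v′ → ⟨ u , v ⟩ ≈ ⟨ u′ , v′ ⟩
  ⟨⟩-cong u≋u′ v≋v′ = sum-cong-≋ (λ i → *-cong (u≋u′ i) (v≋v′ i))

  ⟨⟩-comm : ∀ (u v : Vector Carrier n) → ⟨ u , v ⟩ ≈ ⟨ v , u ⟩
  ⟨⟩-comm u v = sum-cong-≋ (λ i → *-comm (u i) (v i))

  ⟨⟩-zeroˡ : ∀ {u : Vector Carrier n} v → (∀ i → u i ≈ 0#) → ⟨ u , v ⟩ ≈ 0#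
  ⟨⟩-zeroˡ {n} v u≈0 =
    trans (sum-cong-≋ (λ i → trans (*-congʳ (u≈0 i)) (zeroˡ (v i)))) (sum-replicate-zero n)

  ⟨⟩-zeroʳ : ∀ u {v : Vector Carrier n} → (∀ i → v i ≈ 0#) → ⟨ u , v ⟩ ≈ 0#
  ⟨⟩-zeroʳ u {v} v≈0 = trans (⟨⟩-comm u v) (⟨⟩-zeroˡ u v≈0)

  sum-↑ˡ-↑ʳ : ∀ m (f : Vector Carrier (m +ℕ n)) →
              sum f ≈ sum (f ∘ (_↑ˡ n)) + sum (f ∘ (m ↑ʳ_))
  sum-↑ˡ-↑ʳ zero    f = sym (+-identityˡ (sum f))
  sum-↑ˡ-↑ʳ (suc m) f = trans (+-congˡ (sum-↑ˡ-↑ʳ m (f ∘ suc))) (sym (+-assoc _ _ _))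

  ⟨++,⟩ : ∀ (u : Vector Carrier m) (v : Vector Carrier n) w →
          ⟨ u ++ v , w ⟩ ≈ ⟨ u , w ∘ (_↑ˡ n) ⟩ + ⟨ v , w ∘ (m ↑ʳ_) ⟩
  ⟨++,⟩ {m} u v w = trans (sum-↑ˡ-↑ʳ m _) (+-cong
    (sum-cong-≋ (λ i → *-congʳ (reflexive (lookup-++ˡ u v i))))
    (sum-cong-≋ (λ j → *-congʳ (reflexive (lookup-++ʳ u v j)))))

  ⟨++,++⟩ : ∀ (u u′ : Vector Carrier m) (v v′ : Vector Carrier n) →
            ⟨ u ++ v , u′ ++ v′ ⟩ ≈ ⟨ u , u′ ⟩ + ⟨ v , v′ ⟩
  ⟨++,++⟩ u u′ v v′ = trans (⟨++,⟩ u v (u′ ++ v′)) (+-cong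
    (⟨⟩-cong (λ _ → refl) (λ i → reflexive (lookup-++ˡ u′ v′ i)))
    (⟨⟩-cong (λ _ → refl) (λ j → reflexive (lookup-++ʳ u′ v′ j))))

  𝟙-sym : ∀ (i j : Fin n) → 𝟙 i j ≡ 𝟙 j i
  𝟙-sym zero    zero    = ≡.refl
  𝟙-sym zero    (suc j) = ≡.refl
  𝟙-sym (suc i) zero    = ≡.refl
  𝟙-sym (suc i) (suc j) = 𝟙-sym i j

  𝟙-↑ˡ : ∀ (i j : Fin m) → 𝟙 (i ↑ˡ n) (j ↑ˡ n) ≡ 𝟙 i j
  𝟙-↑ˡ zero    zero    = ≡.refl
  𝟙-↑ˡ zero    (suc j) = ≡.refl
  𝟙-↑ˡ (suc i) zero    = ≡.refl
  𝟙-↑ˡ (suc i) (suc j) = 𝟙-↑ˡ i j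

  𝟙-↑ʳ : ∀ m (i j : Fin n) → 𝟙 (m ↑ʳ i) (m ↑ʳ j) ≡ 𝟙 i j
  𝟙-↑ʳ zero    i j = ≡.refl
  𝟙-↑ʳ (suc m) i j = 𝟙-↑ʳ m i j

  𝟙-↑ˡ-↑ʳ : ∀ (i : Fin m) (j : Fin n) → 𝟙 (i ↑ˡ n) (m ↑ʳ j) ≡ 0#
  𝟙-↑ˡ-↑ʳ zero    j = ≡.refl
  𝟙-↑ˡ-↑ʳ (suc i) j = 𝟙-↑ˡ-↑ʳ i j

  𝟙-*ᵛ : ∀ (v : Vector Carrier n) → 𝟙 *ᵛ v ≋ v
  𝟙-*ᵛ v zero = begin
    1# * v zero + ⟨ (λ _ → 0#) , v ∘ suc ⟩  ≈⟨ +-cong (*-identityˡ (v zero)) (⟨⟩-zeroˡ (v ∘ suc) (λ _ → refl)) ⟩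
    v zero + 0#                             ≈⟨ +-identityʳ (v zero) ⟩
    v zero                                  ∎
  𝟙-*ᵛ v (suc i) = begin
    0# * v zero + ⟨ 𝟙 i , v ∘ suc ⟩  ≈⟨ +-cong (zeroˡ (v zero)) (𝟙-*ᵛ (v ∘ suc) i) ⟩
    0# + v (suc i)                   ≈⟨ +-identityˡ (v (suc i)) ⟩
    v (suc i)                        ∎

  ⟨⟩-adjoint : ∀ (u : Vector Carrier m) (M : Matrix m n) v → ⟨ u , M *ᵛ v ⟩ ≈ ⟨ u ᵛ* M , v ⟩
  ⟨⟩-adjoint u M v = begin
    sum (λ i → u i * sum (λ j → M i j * v j))    ≈⟨ sum-cong-≋ (λ i → *-distribˡ-sum (u i) (λ j → M i j * v j)) ⟩
    sum (λ i → sum (λ j → u i * (M i j * v j)))  ≈⟨ ∑-comm (λ i j → u i * (M i j * v j)) ⟩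
    sum (λ j → sum (λ i → u i * (M i j * v j)))  ≈⟨ sum-cong-≋ (λ j → sum-cong-≋ (λ i → *-assoc (u i) (M i j) (v j))) ⟨
    sum (λ j → sum (λ i → u i * M i j * v j))    ≈⟨ sum-cong-≋ (λ j → *-distribʳ-sum (v j) (λ i → u i * M i j)) ⟨
    sum (λ j → sum (λ i → u i * M i j) * v j)    ∎

  ⊥-rows⇒⊥-span : ∀ {M : Matrix m n} {u v} → (∀ r → ⟨ M r , u ⟩ ≈ 0#) → InSpan R M v → ⟨ v , u ⟩ ≈ 0#
  ⊥-rows⇒⊥-span {M = M} {u} {v} M⊥u (y , v≈yM) = begin
    ⟨ v , u ⟩       ≈⟨ ⟨⟩-cong v≈yM (λ _ → refl) ⟩
    ⟨ y ᵛ* M , u ⟩  ≈⟨ ⟨⟩-adjoint y M u ⟨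
    ⟨ y , M *ᵛ u ⟩  ≈⟨ ⟨⟩-zeroʳ y M⊥u ⟩
    0#              ∎

  ⊥-rows⇒span⊆dual : ∀ {M : Matrix m n} → (∀ r s → ⟨ M r , M s ⟩ ≈ 0#) →
                     ∀ {u} → InSpan R M u → InDual R (InSpan R M) u
  ⊥-rows⇒span⊆dual {M = M} M⊥M u∈C v v∈C =
    ⊥-rows⇒⊥-span (λ r → trans (⟨⟩-comm (M r) v) (⊥-rows⇒⊥-span (λ s → M⊥M s r) v∈C)) u∈C

  *ᴹ-congˡ : ∀ {M M′ : Matrix m n} {N : Matrix n k} → M ≈ᴹ M′ → M *ᴹ N ≈ᴹ M′ *ᴹ N
  *ᴹ-congˡ M≈M′ i j = ⟨⟩-cong (M≈M′ i) (λ _ → refl)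

  *ᴹ-congʳ : ∀ {M : Matrix m n} {N N′ : Matrix n k} → N ≈ᴹ N′ → M *ᴹ N ≈ᴹ M *ᴹ N′
  *ᴹ-congʳ N≈N′ i j = ⟨⟩-cong (λ _ → refl) (λ l → N≈N′ l j)

  block : Matrix m m → Matrix m m → Matrix (m +ℕ m) (m +ℕ m)
  block A B = (A ∣ B) ++ (B ᵀ ∣ A ᵀ)

  block-orthonormal : ∀ {A B : Matrix m m} →
    A *ᴹ A ᵀ +ᴹ B *ᴹ B ᵀ ≈ᴹ 𝟙 → A ᵀ *ᴹ A +ᴹ B ᵀ *ᴹ B ≈ᴹ 𝟙 → (∀ i j → (A *ᴹ B +ᴹ B *ᴹ A) i j ≈ 0#) →
    block A B *ᴹ block A B ᵀ ≈ᴹ 𝟙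
  block-orthonormal {m} {A} {B} rows cols AB+BA≈0 =
    ↑-elim (λ r → ∀ s → Orth r s)
      (λ i → ↑-elim (Orth (i ↑ˡ m)) (upper-upper i) (upper-lower i))
      (λ i → ↑-elim (Orth (m ↑ʳ i)) (lower-upper i) (lower-lower i))
    where
    Orth : Fin (m +ℕ m) → Fin (m +ℕ m) → Set ℓ
    Orth r s = ⟨ block A B r , block A B s ⟩ ≈ 𝟙 r s

    upperᵢ : ∀ i → block A B (i ↑ˡ m) ≡ A i ++ B i
    upperᵢ = lookup-++ˡ (A ∣ B) (B ᵀ ∣ A ᵀ)

    lowerᵢ : ∀ i → block A B (m ↑ʳ i) ≡ (B ᵀ) i ++ (A ᵀ) i
    lowerᵢ = lookup-++ʳ (A ∣ B) (B ᵀ ∣ A ᵀ)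

    upper-upper : ∀ i j → Orth (i ↑ˡ m) (j ↑ˡ m)
    upper-upper i j = begin
      ⟨ block A B (i ↑ˡ m) , block A B (j ↑ˡ m) ⟩  ≡⟨ ≡.cong₂ ⟨_,_⟩ (upperᵢ i) (upperᵢ j) ⟩
      ⟨ A i ++ B i , A j ++ B j ⟩                  ≈⟨ ⟨++,++⟩ (A i) (A j) (B i) (B j) ⟩
      ⟨ A i , A j ⟩ + ⟨ B i , B j ⟩                ≈⟨ rows i j ⟩
      𝟙 i j                                        ≡⟨ 𝟙-↑ˡ i j ⟨
      𝟙 (i ↑ˡ m) (j ↑ˡ m)                          ∎

    upper-lower : ∀ i j → Orth (i ↑ˡ m) (m ↑ʳ j)
    upper-lower i j = begin
      ⟨ block A B (i ↑ˡ m) , block A B (m ↑ʳ j) ⟩  ≡⟨ ≡.cong₂ ⟨_,_⟩ (upperᵢ i) (lowerᵢ j) ⟩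
      ⟨ A i ++ B i , (B ᵀ) j ++ (A ᵀ) j ⟩          ≈⟨ ⟨++,++⟩ (A i) ((B ᵀ) j) (B i) ((A ᵀ) j) ⟩
      (A *ᴹ B +ᴹ B *ᴹ A) i j                       ≈⟨ AB+BA≈0 i j ⟩
      0#                                           ≡⟨ 𝟙-↑ˡ-↑ʳ i j ⟨
      𝟙 (i ↑ˡ m) (m ↑ʳ j)                          ∎

    lower-upper : ∀ i j → Orth (m ↑ʳ i) (j ↑ˡ m)
    lower-upper i j = begin
      ⟨ block A B (m ↑ʳ i) , block A B (j ↑ˡ m) ⟩  ≈⟨ ⟨⟩-comm (block A B (m ↑ʳ i)) (block A B (j ↑ˡ m)) ⟩
      ⟨ block A B (j ↑ˡ m) , block A B (m ↑ʳ i) ⟩  ≈⟨ upper-lower j i ⟩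
      𝟙 (j ↑ˡ m) (m ↑ʳ i)                          ≡⟨ 𝟙-sym (j ↑ˡ m) (m ↑ʳ i) ⟩
      𝟙 (m ↑ʳ i) (j ↑ˡ m)                          ∎

    lower-lower : ∀ i j → Orth (m ↑ʳ i) (m ↑ʳ j)
    lower-lower i j = begin
      ⟨ block A B (m ↑ʳ i) , block A B (m ↑ʳ j) ⟩      ≡⟨ ≡.cong₂ ⟨_,_⟩ (lowerᵢ i) (lowerᵢ j) ⟩
      ⟨ (B ᵀ) i ++ (A ᵀ) i , (B ᵀ) j ++ (A ᵀ) j ⟩      ≈⟨ ⟨++,++⟩ ((B ᵀ) i) ((B ᵀ) j) ((A ᵀ) i) ((A ᵀ) j) ⟩
      ⟨ (B ᵀ) i , (B ᵀ) j ⟩ + ⟨ (A ᵀ) i , (A ᵀ) j ⟩  ≈⟨ +-comm _ _ ⟩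
      ⟨ (A ᵀ) i , (A ᵀ) j ⟩ + ⟨ (B ᵀ) i , (B ᵀ) j ⟩  ≈⟨ cols i j ⟩
      𝟙 i j                                            ≡⟨ 𝟙-↑ʳ m i j ⟨
      𝟙 (m ↑ʳ i) (m ↑ʳ j)                              ∎

module SelfDualCode {c ℓ} (R : CommutativeRing c ℓ) (char2 : HasChar2 R) (finite : IsFiniteRing R) where
  open CommutativeRing R hiding (zero)
  open Matrices R
  open Characteristic2 R char2
  open import Data.Vec.Functional.Relation.Binary.Equality.Setoid setoid using (_≋_; ≋-setoid)
  open import Relation.Binary.Reasoning.Setoid setoid

  module _ {n} {X : Matrix n n} (XXᵀ≈𝟙 : X *ᴹ X ᵀ ≈ᴹ 𝟙) where

    X*ᵛ[vᵛ*X]≋v : ∀ v → X *ᵛ (v ᵛ* X) ≋ v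
    X*ᵛ[vᵛ*X]≋v v i = begin
      ⟨ X i , v ᵛ* X ⟩  ≈⟨ ⟨⟩-comm (X i) (v ᵛ* X) ⟩
      ⟨ v ᵛ* X , X i ⟩  ≈⟨ ⟨⟩-adjoint v X (X i) ⟨
      ⟨ v , X *ᵛ X i ⟩  ≈⟨ ⟨⟩-cong (λ _ → refl) (λ j → trans (XXᵀ≈𝟙 j i) (reflexive (𝟙-sym j i))) ⟩
      ⟨ v , 𝟙 i ⟩       ≈⟨ ⟨⟩-comm v (𝟙 i) ⟩
      ⟨ 𝟙 i , v ⟩       ≈⟨ 𝟙-*ᵛ v i ⟩
      v i               ∎

    [X*ᵛv]ᵛ*X≋v : ∀ v → (X *ᵛ v) ᵛ* X ≋ v
    [X*ᵛv]ᵛ*X≋v = inverseˡ⇒inverseʳ (≋-setoid n) (Vector-finite setoid finite n)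
      (λ u≋v i → ⟨⟩-cong (λ _ → refl) u≋v) (λ u≋v j → ⟨⟩-cong u≋v (λ _ → refl)) X*ᵛ[vᵛ*X]≋v

    module _ {M : Matrix n (n +ℕ n)} (M≈𝟙∣X : M ≈ᴹ 𝟙 ∣ X) where

      M-left : ∀ r k → M r (k ↑ˡ n) ≈ 𝟙 r k
      M-left r k = trans (M≈𝟙∣X r (k ↑ˡ n)) (reflexive (lookup-++ˡ (𝟙 r) (X r) k))

      M-right : ∀ r k → M r (n ↑ʳ k) ≈ X r k
      M-right r k = trans (M≈𝟙∣X r (n ↑ʳ k)) (reflexive (lookup-++ʳ (𝟙 r) (X r) k))

      ⟨M,⟩ : ∀ r w → ⟨ M r , w ⟩ ≈ w (r ↑ˡ n) + ⟨ X r , w ∘ (n ↑ʳ_) ⟩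
      ⟨M,⟩ r w = begin
        ⟨ M r , w ⟩                                      ≈⟨ ⟨⟩-cong (M≈𝟙∣X r) (λ _ → refl) ⟩
        ⟨ 𝟙 r ++ X r , w ⟩                               ≈⟨ ⟨++,⟩ (𝟙 r) (X r) w ⟩
        ⟨ 𝟙 r , w ∘ (_↑ˡ n) ⟩ + ⟨ X r , w ∘ (n ↑ʳ_) ⟩  ≈⟨ +-congʳ (𝟙-*ᵛ (w ∘ (_↑ˡ n)) r) ⟩
        w (r ↑ˡ n) + ⟨ X r , w ∘ (n ↑ʳ_) ⟩              ∎

      rows⊥ : ∀ r s → ⟨ M r , M s ⟩ ≈ 0#
      rows⊥ r s = begin
        ⟨ M r , M s ⟩                            ≈⟨ ⟨M,⟩ r (M s) ⟩
        M s (r ↑ˡ n) + ⟨ X r , M s ∘ (n ↑ʳ_) ⟩  ≈⟨ +-cong (M-left s r) (⟨⟩-cong (λ _ → refl) (M-right s)) ⟩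
        𝟙 s r + ⟨ X r , X s ⟩                    ≈⟨ +-cong (reflexive (𝟙-sym s r)) (XXᵀ≈𝟙 r s) ⟩
        𝟙 r s + 𝟙 r s                            ≈⟨ x+x≈0 (𝟙 r s) ⟩
        0#                                       ∎

      row∈span : ∀ r → InSpan R M (M r)
      row∈span r = 𝟙 r , λ j → sym (𝟙-*ᵛ (λ i → M i j) r)

      dual⊆span : ∀ {w} → InDual R (InSpan R M) w → InSpan R M w
      dual⊆span {w} w∈C⊥ = a , ↑-elim (λ col → w col ≈ (a ᵛ* M) col) left right
        where
        a b : Vector Carrier n
        a = w ∘ (_↑ˡ n)
        b = w ∘ (n ↑ʳ_)

        a≋X*ᵛb : a ≋ X *ᵛ b
        a≋X*ᵛb r = x+y≈0⇒x≈y (begin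
          a r + ⟨ X r , b ⟩  ≈⟨ ⟨M,⟩ r w ⟨
          ⟨ M r , w ⟩        ≈⟨ ⟨⟩-comm (M r) w ⟩
          ⟨ w , M r ⟩        ≈⟨ w∈C⊥ (M r) (row∈span r) ⟩
          0#                 ∎)

        left : ∀ k → w (k ↑ˡ n) ≈ (a ᵛ* M) (k ↑ˡ n)
        left k = sym (begin
          ⟨ a , (M ᵀ) (k ↑ˡ n) ⟩  ≈⟨ ⟨⟩-cong (λ _ → refl) (λ i → trans (M-left i k) (reflexive (𝟙-sym i k))) ⟩
          ⟨ a , 𝟙 k ⟩             ≈⟨ ⟨⟩-comm a (𝟙 k) ⟩
          ⟨ 𝟙 k , a ⟩             ≈⟨ 𝟙-*ᵛ a k ⟩
          a k                     ∎)

        right : ∀ k → w (n ↑ʳ k) ≈ (a ᵛ* M) (n ↑ʳ k)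
        right k = sym (begin
          ⟨ a , (M ᵀ) (n ↑ʳ k) ⟩  ≈⟨ ⟨⟩-cong a≋X*ᵛb (λ i → M-right i k) ⟩
          ((X *ᵛ b) ᵛ* X) k       ≈⟨ [X*ᵛv]ᵛ*X≋v b k ⟩
          b k                     ∎)

      𝟙∣X-selfDual : SelfDual R (InSpan R M)
      𝟙∣X-selfDual w = mk⇔ (⊥-rows⇒span⊆dual rows⊥) dual⊆span

module GroupRing {c ℓ} (R : CommutativeRing c ℓ) {p} (G : FinGroup p) where
  open CommutativeRing R hiding (zero)
  open FinGroup G
  open Matrices R
  open import Algebra.Properties.Semiring.Sum semiring using (sum; sum-cong-≋; sum-cong-≗; sum-permute)
  open import Relation.Binary.Reasoning.Setoid setoid

  group : Group 0ℓ 0ℓ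
  group = record { isGroup = isGroup }

  open Group group using (assoc; inverseˡ)
  open import Algebra.Properties.Group group
    using (⁻¹-anti-homo-∙; ⁻¹-involutive; inverseʳ-unique; \\-leftDividesˡ; \\-leftDividesʳ; //-rightDividesˡ)

  infixl 7 _⊛_
  infixl 6 _⊕_
  infixr 7 _•_
  infix  8 _⋆ᴳ

  _⊛_ : RG R G → RG R G → RG R G
  _⊛_ = _·RG_ R G

  _⊕_ : RG R G → RG R G → RG R G
  _⊕_ = _+RG_ R G

  _•_ : Carrier → RG R G → RG R G
  _•_ = _•RG_ R G

  _⋆ᴳ : RG R G → RG R G
  _⋆ᴳ = _⋆ R G

  sum-·ˡ : ∀ (f : Vector Carrier p) g → sum f ≈ sum (λ h → f (g · h))
  sum-·ˡ f g = sum-permute f (permutation (g ·_) (inv g ·_) (\\-leftDividesˡ g) (\\-leftDividesʳ g))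

  sum-inv : ∀ (f : Vector Carrier p) → sum f ≈ sum (λ h → f (inv h))
  sum-inv f = sum-permute f (permutation inv inv ⁻¹-involutive ⁻¹-involutive)

  aug-⋆ : ∀ v → aug R G (v ⋆ᴳ) ≈ aug R G v
  aug-⋆ v = sym (sum-inv v)

  σ-rowSum : ∀ v i → sum (σ R G v i) ≈ aug R G v
  σ-rowSum v i = begin
    sum (λ k → v (inv i · k))        ≈⟨ sum-·ˡ (λ k → v (inv i · k)) i ⟩
    sum (λ h → v (inv i · (i · h)))  ≡⟨ sum-cong-≗ (λ h → ≡.cong v (\\-leftDividesʳ i h)) ⟩
    sum v                            ∎

  σ-colSum : ∀ v j → sum (λ k → σ R G v k j) ≈ aug R G v
  σ-colSum v j = begin
    sum (λ k → v (inv k · j))        ≈⟨ sum-·ˡ (λ k → v (inv k · j)) j ⟩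
    sum (λ h → v (inv (j · h) · j))  ≡⟨ sum-cong-≗ (λ h → ≡.cong v (inv[jh]j≡inv-h h)) ⟩
    sum (λ h → v (inv h))            ≈⟨ sum-inv v ⟨
    sum v                            ∎
    where
    inv[jh]j≡inv-h : ∀ h → inv (j · h) · j ≡ inv h
    inv[jh]j≡inv-h h = ≡.trans (≡.cong (_· j) (⁻¹-anti-homo-∙ j h)) (//-rightDividesˡ j (inv h))

  σ-*-σ : ∀ v w → σ R G v *ᴹ σ R G w ≈ᴹ σ R G (v ⊛ w)
  σ-*-σ v w i j = begin
    sum (λ k → v (inv i · k) * w (inv k · j))              ≈⟨ sum-·ˡ _ i ⟩
    sum (λ h → v (inv i · (i · h)) * w (inv (i · h) · j))  ≡⟨ sum-cong-≗ (λ h → ≡.cong₂ _*_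
                                                                (≡.cong v (\\-leftDividesʳ i h)) (≡.cong w (inv[ih]j h))) ⟩
    sum (λ h → v h * w (inv h · (inv i · j)))              ∎
    where
    inv[ih]j : ∀ h → inv (i · h) · j ≡ inv h · (inv i · j)
    inv[ih]j h = ≡.trans (≡.cong (_· j) (⁻¹-anti-homo-∙ i h)) (assoc (inv h) (inv i) j)

  σ-ᵀ : ∀ v → σ R G v ᵀ ≈ᴹ σ R G (v ⋆ᴳ)
  σ-ᵀ v i j = reflexive (≡.cong v (≡.sym inv[inv-i·j]))
    where
    inv[inv-i·j] : inv (inv i · j) ≡ inv j · i
    inv[inv-i·j] = ≡.trans (⁻¹-anti-homo-∙ (inv i) j) (≡.cong (inv j ·_) (⁻¹-involutive i))

  σ-1 : ∀ i j → σ R G (1RG R G) i j ≡ 𝟙 i j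
  σ-1 i j = ≡.trans (1RG-if (inv i · j))
    (≡.cong (if_then 1# else 0#) (does-⇔ inv-i·j≡e⇔i≡j (inv i · j ≟ e) (i ≟ j)))
    where
    1RG-if : ∀ g → 1RG R G g ≡ (if does (g ≟ e) then 1# else 0#)
    1RG-if g with g ≟ e
    ... | yes _ = ≡.refl
    ... | no  _ = ≡.refl

    inv-i·j≡e⇔i≡j : inv i · j ≡ e ⇔ i ≡ j
    inv-i·j≡e⇔i≡j = mk⇔ (λ eq → ≡.sym (≡.trans (inverseʳ-unique (inv i) j eq) (⁻¹-involutive i)))
                         (λ { ≡.refl → inverseˡ i })

  Mσ≡𝟙∣block : ∀ γ₁ γ₂ γ₃ γ₄ v₁ v₂ r col →
    Mσ R G γ₁ γ₂ γ₃ γ₄ v₁ v₂ r col ≡ (𝟙 ∣ block (bordered R G γ₁ γ₂ v₁) (bordered R G γ₃ γ₄ v₂)) r col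
  Mσ≡𝟙∣block γ₁ γ₂ γ₃ γ₄ v₁ v₂ r col with splitAt (suc p +ℕ suc p) col
  ... | inj₁ k with r ≟ k
  ...   | yes _ = ≡.refl
  ...   | no  _ = ≡.refl
  Mσ≡𝟙∣block γ₁ γ₂ γ₃ γ₄ v₁ v₂ r col | inj₂ k with splitAt (suc p) r
  ... | inj₁ i with splitAt (suc p) k
  ...   | inj₁ j = ≡.refl
  ...   | inj₂ j = ≡.refl
  Mσ≡𝟙∣block γ₁ γ₂ γ₃ γ₄ v₁ v₂ r col | inj₂ k | inj₂ i with splitAt (suc p) k
  ...   | inj₁ j = ≡.refl
  ...   | inj₂ j = ≡.refl

module Bordered {c ℓ} (R : CommutativeRing c ℓ) (char2 : HasChar2 R) {p} (G : FinGroup p) (p-odd : p % 2 ≡ 1) where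
  open CommutativeRing R hiding (zero)
  open Matrices R
  open Characteristic2 R char2
  open FinGroup G using (_·_; inv)
  open GroupRing R G
  open import Algebra.Properties.Semiring.Sum semiring using (sum; *-distribˡ-sum; *-distribʳ-sum)
  open import Algebra.Properties.CommutativeSemigroup +-commutativeSemigroup using (interchange)
  open import Data.Vec.Functional.Relation.Binary.Equality.Setoid setoid using (_≋_)
  open import Relation.Binary.Reasoning.Setoid setoid

  ⟦_,_,_⟧ : Carrier → Carrier → RG R G → Matrix (suc p) (suc p)
  ⟦ a , b , v ⟧ = bordered R G a b v

  bordered-cong : ∀ {a a′ b b′ v v′} → a ≈ a′ → b ≈ b′ → v ≋ v′ → ⟦ a , b , v ⟧ ≈ᴹ ⟦ a′ , b′ , v′ ⟧
  bordered-cong a≈a′ b≈b′ v≋v′ zero    zero    = a≈a′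
  bordered-cong a≈a′ b≈b′ v≋v′ zero    (suc j) = b≈b′
  bordered-cong a≈a′ b≈b′ v≋v′ (suc i) zero    = b≈b′
  bordered-cong a≈a′ b≈b′ v≋v′ (suc i) (suc j) = v≋v′ (inv i · j)

  bordered-ᵀ : ∀ a b v → ⟦ a , b , v ⟧ ᵀ ≈ᴹ ⟦ a , b , v ⋆ᴳ ⟧
  bordered-ᵀ a b v zero    zero    = refl
  bordered-ᵀ a b v zero    (suc j) = refl
  bordered-ᵀ a b v (suc i) zero    = refl
  bordered-ᵀ a b v (suc i) (suc j) = σ-ᵀ v i j

  -- Row and column sums of σ w equal aug w, and the p border products b b′ add up to b b′ as p is odd.
  bordered-*-bordered : ∀ {a b v a′ b′ w} → a ≈ aug R G v → a′ ≈ aug R G w →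
    ⟦ a , b , v ⟧ *ᴹ ⟦ a′ , b′ , w ⟧ ≈ᴹ ⟦ a * a′ + b * b′ , a * b′ + b * a′ , (b * b′) • ghat R G ⊕ v ⊛ w ⟧
  bordered-*-bordered {b = b} {b′ = b′} _ _ zero zero = +-congˡ (sum-const-odd p p-odd (b * b′))
  bordered-*-bordered {b = b} {a′ = a′} {w = w} _ a′≈aug-w zero (suc j) = +-congˡ (begin
    sum (λ k → b * σ R G w k j)  ≈⟨ *-distribˡ-sum b (λ k → σ R G w k j) ⟨
    b * sum (λ k → σ R G w k j)  ≈⟨ *-congˡ (trans (σ-colSum w j) (sym a′≈aug-w)) ⟩
    b * a′                       ∎)
  bordered-*-bordered {a} {b} {v} {a′} {b′} a≈aug-v _ (suc i) zero = begin
    b * a′ + sum (λ k → σ R G v i k * b′)  ≈⟨ +-congˡ (*-distribʳ-sum b′ (σ R G v i)) ⟨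
    b * a′ + sum (σ R G v i) * b′          ≈⟨ +-congˡ (*-congʳ (trans (σ-rowSum v i) (sym a≈aug-v))) ⟩
    b * a′ + a * b′                        ≈⟨ +-comm (b * a′) (a * b′) ⟩
    a * b′ + b * a′                        ∎
  bordered-*-bordered {b = b} {v} {b′ = b′} {w} _ _ (suc i) (suc j) =
    +-cong (sym (*-identityʳ (b * b′))) (σ-*-σ v w i j)

  bordered-comm : ∀ {a b v a′ b′ w} → a ≈ aug R G v → a′ ≈ aug R G w → v ⊛ w ≋ w ⊛ v →
    ⟦ a , b , v ⟧ *ᴹ ⟦ a′ , b′ , w ⟧ ≈ᴹ ⟦ a′ , b′ , w ⟧ *ᴹ ⟦ a , b , v ⟧
  bordered-comm {a} {b} {v} {a′} {b′} {w} a≈aug-v a′≈aug-w vw≋wv i j = begin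
    (⟦ a , b , v ⟧ *ᴹ ⟦ a′ , b′ , w ⟧) i j
      ≈⟨ bordered-*-bordered a≈aug-v a′≈aug-w i j ⟩
    ⟦ a * a′ + b * b′ , a * b′ + b * a′ , (b * b′) • ghat R G ⊕ v ⊛ w ⟧ i j
      ≈⟨ bordered-cong (+-cong (*-comm a a′) (*-comm b b′))
                       (trans (+-comm (a * b′) (b * a′)) (+-cong (*-comm b a′) (*-comm a b′)))
                       (λ g → +-cong (*-congʳ (*-comm b b′)) (vw≋wv g)) i j ⟩
    ⟦ a′ * a + b′ * b , a′ * b + b′ * a , (b′ * b) • ghat R G ⊕ w ⊛ v ⟧ i j
      ≈⟨ bordered-*-bordered a′≈aug-w a≈aug-v i j ⟨
    (⟦ a′ , b′ , w ⟧ *ᴹ ⟦ a , b , v ⟧) i j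
      ∎

  bordered-pair≈𝟙 : ∀ {γ₁ γ₂ γ₃ γ₄ v₁ w₁ v₂ w₂} →
    γ₁ ≈ aug R G v₁ → γ₁ ≈ aug R G w₁ → γ₃ ≈ aug R G v₂ → γ₃ ≈ aug R G w₂ →
    γ₁ * γ₁ + γ₂ * γ₂ + γ₃ * γ₃ + γ₄ * γ₄ ≈ 1# →
    v₁ ⊛ w₁ ⊕ v₂ ⊛ w₂ ⊕ ((γ₂ + γ₄) * (γ₂ + γ₄)) • ghat R G ⊕ 1RG R G ≋ 0RG R G →
    ⟦ γ₁ , γ₂ , v₁ ⟧ *ᴹ ⟦ γ₁ , γ₂ , w₁ ⟧ +ᴹ ⟦ γ₃ , γ₄ , v₂ ⟧ *ᴹ ⟦ γ₃ , γ₄ , w₂ ⟧ ≈ᴹ 𝟙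
  bordered-pair≈𝟙 {γ₁} {γ₂} {γ₃} {γ₄} {v₁} {w₁} {v₂} {w₂} γ₁≈v₁ γ₁≈w₁ γ₃≈v₂ γ₃≈w₂ Σγ²≈1 vw+vw+ĝ+1≈0 i j =
    trans (+-cong (bordered-*-bordered γ₁≈v₁ γ₁≈w₁ i j) (bordered-*-bordered γ₃≈v₂ γ₃≈w₂ i j)) (sum≈𝟙 i j)
    where
    border≈0 : (γ₁ * γ₂ + γ₂ * γ₁) + (γ₃ * γ₄ + γ₄ * γ₃) ≈ 0#
    border≈0 = trans (+-cong (x≈y⇒x+y≈0 (*-comm γ₁ γ₂)) (x≈y⇒x+y≈0 (*-comm γ₃ γ₄))) (+-identityʳ 0#)

    inner≈1 : ∀ g → ((γ₂ * γ₂) * 1# + (v₁ ⊛ w₁) g) + ((γ₄ * γ₄) * 1# + (v₂ ⊛ w₂) g) ≈ 1RG R G g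
    inner≈1 g = begin
      ((γ₂ * γ₂) * 1# + (v₁ ⊛ w₁) g) + ((γ₄ * γ₄) * 1# + (v₂ ⊛ w₂) g)
        ≈⟨ interchange _ _ _ _ ⟩
      ((γ₂ * γ₂) * 1# + (γ₄ * γ₄) * 1#) + ((v₁ ⊛ w₁) g + (v₂ ⊛ w₂) g)
        ≈⟨ +-comm _ _ ⟩
      ((v₁ ⊛ w₁) g + (v₂ ⊛ w₂) g) + ((γ₂ * γ₂) * 1# + (γ₄ * γ₄) * 1#)
        ≈⟨ +-congˡ (trans (sym (distribʳ 1# (γ₂ * γ₂) (γ₄ * γ₄))) (*-congʳ (sym ([x+y]²≈x²+y² γ₂ γ₄)))) ⟩
      ((v₁ ⊛ w₁) g + (v₂ ⊛ w₂) g) + ((γ₂ + γ₄) * (γ₂ + γ₄)) * 1#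
        ≈⟨ x+y≈0⇒x≈y (vw+vw+ĝ+1≈0 g) ⟩
      1RG R G g
        ∎

    sum≈𝟙 : ⟦ γ₁ * γ₁ + γ₂ * γ₂ , γ₁ * γ₂ + γ₂ * γ₁ , (γ₂ * γ₂) • ghat R G ⊕ v₁ ⊛ w₁ ⟧ +ᴹ
            ⟦ γ₃ * γ₃ + γ₄ * γ₄ , γ₃ * γ₄ + γ₄ * γ₃ , (γ₄ * γ₄) • ghat R G ⊕ v₂ ⊛ w₂ ⟧ ≈ᴹ 𝟙
    sum≈𝟙 zero    zero    = trans (sym (+-assoc _ _ _)) Σγ²≈1
    sum≈𝟙 zero    (suc j) = border≈0
    sum≈𝟙 (suc i) zero    = border≈0
    sum≈𝟙 (suc i) (suc j) = trans (inner≈1 (inv i · j)) (reflexive (σ-1 i j))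

  module _ {γ₁ γ₂ γ₃ γ₄ v₁ v₂} (γ₁≈aug-v₁ : γ₁ ≈ aug R G v₁) (γ₃≈aug-v₂ : γ₃ ≈ aug R G v₂)
           (Σγ²≈1 : γ₁ * γ₁ + γ₂ * γ₂ + γ₃ * γ₃ + γ₄ * γ₄ ≈ 1#) where

    private
      A B : Matrix (suc p) (suc p)
      A = ⟦ γ₁ , γ₂ , v₁ ⟧
      B = ⟦ γ₃ , γ₄ , v₂ ⟧

      γ₁≈aug-v₁⋆ : γ₁ ≈ aug R G (v₁ ⋆ᴳ)
      γ₁≈aug-v₁⋆ = trans γ₁≈aug-v₁ (sym (aug-⋆ v₁))

      γ₃≈aug-v₂⋆ : γ₃ ≈ aug R G (v₂ ⋆ᴳ)
      γ₃≈aug-v₂⋆ = trans γ₃≈aug-v₂ (sym (aug-⋆ v₂))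

    bordered-rows-orthonormal :
      v₁ ⊛ v₁ ⋆ᴳ ⊕ v₂ ⊛ v₂ ⋆ᴳ ⊕ ((γ₂ + γ₄) * (γ₂ + γ₄)) • ghat R G ⊕ 1RG R G ≋ 0RG R G →
      A *ᴹ A ᵀ +ᴹ B *ᴹ B ᵀ ≈ᴹ 𝟙
    bordered-rows-orthonormal vv⋆+vv⋆+ĝ+1≈0 i j = trans
      (+-cong (*ᴹ-congʳ {M = A} (bordered-ᵀ γ₁ γ₂ v₁) i j) (*ᴹ-congʳ {M = B} (bordered-ᵀ γ₃ γ₄ v₂) i j))
      (bordered-pair≈𝟙 γ₁≈aug-v₁ γ₁≈aug-v₁⋆ γ₃≈aug-v₂ γ₃≈aug-v₂⋆ Σγ²≈1 vv⋆+vv⋆+ĝ+1≈0 i j)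

    bordered-cols-orthonormal :
      v₁ ⋆ᴳ ⊛ v₁ ⊕ v₂ ⋆ᴳ ⊛ v₂ ⊕ ((γ₂ + γ₄) * (γ₂ + γ₄)) • ghat R G ⊕ 1RG R G ≋ 0RG R G →
      A ᵀ *ᴹ A +ᴹ B ᵀ *ᴹ B ≈ᴹ 𝟙
    bordered-cols-orthonormal v⋆v+v⋆v+ĝ+1≈0 i j = trans
      (+-cong (*ᴹ-congˡ {N = A} (bordered-ᵀ γ₁ γ₂ v₁) i j) (*ᴹ-congˡ {N = B} (bordered-ᵀ γ₃ γ₄ v₂) i j))
      (bordered-pair≈𝟙 γ₁≈aug-v₁⋆ γ₁≈aug-v₁ γ₃≈aug-v₂⋆ γ₃≈aug-v₂ Σγ²≈1 v⋆v+v⋆v+ĝ+1≈0 i j)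

mainTheorem1 : {c ℓ : Level} (R : CommutativeRing c ℓ) →
  IsFiniteRing R → IsFrobenius R → HasChar2 R →
  {p : ℕ} (G : FinGroup p) → p % 2 ≡ 1 →
  (v₁ v₂ : RG R G) (γ₁ γ₂ γ₃ γ₄ : CommutativeRing.Carrier R) →
  let open CommutativeRing R
      _·_ = _·RG_ R G
      _⊕_ = _+RG_ R G
      _≋_ = _≈RG_ R G
      st = _⋆ R G
      sc = _•RG_ R G
  in (v₁ · v₂) ≋ (v₂ · v₁) →
     (γ₁ * γ₁) + (γ₂ * γ₂) + (γ₃ * γ₃) + (γ₄ * γ₄) ≈ 1# →
     ((((v₁ · st v₁) ⊕ (v₂ · st v₂)) ⊕ sc ((γ₂ + γ₄) * (γ₂ + γ₄)) (ghat R G)) ⊕ 1RG R G) ≋ 0RG R G →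
     ((((st v₁ · v₁) ⊕ (st v₂ · v₂)) ⊕ sc ((γ₂ + γ₄) * (γ₂ + γ₄)) (ghat R G)) ⊕ 1RG R G) ≋ 0RG R G →
     γ₁ ≈ aug R G v₁ → γ₃ ≈ aug R G v₂ →
     SelfDual R (InSpan R (Mσ R G γ₁ γ₂ γ₃ γ₄ v₁ v₂))
mainTheorem1 R finite _ char2 {p} G p-odd v₁ v₂ γ₁ γ₂ γ₃ γ₄ v₁v₂≈v₂v₁ Σγ²≈1 rows cols γ₁≈aug-v₁ γ₃≈aug-v₂ =
  𝟙∣X-selfDual X-orthonormal (λ r col → reflexive (Mσ≡𝟙∣block γ₁ γ₂ γ₃ γ₄ v₁ v₂ r col))
  where
  open CommutativeRing R using (reflexive)
  open Matrices R
  open Characteristic2 R char2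
  open SelfDualCode R char2 finite
  open GroupRing R G
  open Bordered R char2 G p-odd

  X : Matrix (suc p +ℕ suc p) (suc p +ℕ suc p)
  X = block ⟦ γ₁ , γ₂ , v₁ ⟧ ⟦ γ₃ , γ₄ , v₂ ⟧

  X-orthonormal : X *ᴹ X ᵀ ≈ᴹ 𝟙
  X-orthonormal = block-orthonormal
    (bordered-rows-orthonormal γ₁≈aug-v₁ γ₃≈aug-v₂ Σγ²≈1 rows)
    (bordered-cols-orthonormal γ₁≈aug-v₁ γ₃≈aug-v₂ Σγ²≈1 cols)
    (λ i j → x≈y⇒x+y≈0 (bordered-comm γ₁≈aug-v₁ γ₃≈aug-v₂ v₁v₂≈v₂v₁ i j))
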